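{- Let $H$ be a graph with no $K_5$ minor. If $H$ contains $D_n$ as an induced subgraph for some $n\ge 3$, then $H\models\phi$, where \[\chi(x_1,x_2,y_1,z_1,y_2,z_2):=E(x_1,y_2)\wedge E(y_1,y_2)\wedge E(z_1,y_2)\wedge E(z_1,z_2)\wedge E(y_2,z_2)\wedge E(z_2,x_2),\] \[\phi:=\exists x_1,x_2,y,z\,[E(x_1,y)\wedge E(y,z)\wedge E(z,x_2)\wedge\forall a,b\,((E(x_1,a)\wedge E(a,b)\wedge E(b,x_2))\to\exists c,d\ \chi(x_1,x_2,a,b,c,d))].\]
   Context: Graphs are simple and undirected, with edge relation $E$. For $n\ge 3$, $D_n$ is the graph with vertex set $\{v_1,v_2\}\cup\{a_i,b_i:i\in[n]\}$ and edges $(v_1,a_i),(v_2,b_i),(a_i,b_i)$ for $i\in[n]$, $(a_i,a_{i+1}),(b_i,b_{i+1}),(a_{i+1},b_i)$ for $i\in[n-1]$, and $(a_1,a_n),(b_1,b_n),(a_1,b_n)$. -}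

module Defs where

open import Data.Nat using (ℕ; zero; suc; _≤_)
open import Data.Fin using (Fin; toℕ)
open import Data.Maybe using (Maybe; just)
open import Data.Product using (Σ; _×_; _,_)
open import Data.Sum using (_⊎_)
open import Data.Empty using (⊥)
open import Relation.Nullary using (¬_; Dec)
open import Relation.Binary.PropositionalEquality using (_≡_; _≢_)

record Graph : Set₁ where
  field
    N      : ℕ
    E      : Fin N → Fin N → Set
    E-sym  : ∀ {u v} → E u v → E v u
    E-irr  : ∀ {u} → ¬ E u u
    E-dec  : ∀ u v → Dec (E u v)
open Graph public

-- The graph D_n (indices i ∈ [n] are represented as Fin n, i ↦ i-1)

data DV (n : ℕ) : Set where
  v₁ v₂ : DV n
  a b   : Fin n → DV n

-- the listed (unordered) edges, each listed once in one orientation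
data DBase (n : ℕ) : DV n → DV n → Set where
  e-v₁a : ∀ i → DBase n v₁ (a i)
  e-v₂b : ∀ i → DBase n v₂ (b i)
  e-ab  : ∀ i → DBase n (a i) (b i)
  -- (a_i, a_{i+1}), (b_i, b_{i+1}), (a_{i+1}, b_i) for i ∈ [n-1]
  e-aa  : ∀ i j → suc (toℕ i) ≡ toℕ j → DBase n (a i) (a j)
  e-bb  : ∀ i j → suc (toℕ i) ≡ toℕ j → DBase n (b i) (b j)
  e-a'b : ∀ i j → suc (toℕ i) ≡ toℕ j → DBase n (a j) (b i)
  -- (a_1, a_n), (b_1, b_n), (a_1, b_n)
  w-aa  : ∀ i j → toℕ i ≡ 0 → suc (toℕ j) ≡ n → DBase n (a i) (a j)
  w-bb  : ∀ i j → toℕ i ≡ 0 → suc (toℕ j) ≡ n → DBase n (b i) (b j)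
  w-ab  : ∀ i j → toℕ i ≡ 0 → suc (toℕ j) ≡ n → DBase n (a i) (b j)

DE : (n : ℕ) → DV n → DV n → Set
DE n u v = DBase n u v ⊎ DBase n v u

InducedD : (n : ℕ) (H : Graph) → Set
InducedD n H =
  Σ (DV n → Fin (N H)) λ f →
    (∀ u v → f u ≡ f v → u ≡ v) ×
    (∀ u v → (DE n u v → E H (f u) (f v)) × (E H (f u) (f v) → DE n u v))

-- K₅ minor, via branch sets: β assigns each vertex to at most one of
-- five branch sets (so they are disjoint); each branch set is nonempty
-- and connected, and any two distinct branch sets are joined by an edge.

data WalkIn (H : Graph) (P : Fin (N H) → Set) : Fin (N H) → Fin (N H) → Set where
  here : ∀ {u} → P u → WalkIn H P u u
  step : ∀ {u w v} → P u → E H u w → WalkIn H P w v → WalkIn H P u v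

HasK5Minor : Graph → Set
HasK5Minor H =
  Σ (Fin (N H) → Maybe (Fin 5)) λ β →
    (∀ i → Σ (Fin (N H)) λ u → β u ≡ just i) ×
    (∀ i u v → β u ≡ just i → β v ≡ just i →
       WalkIn H (λ w → β w ≡ just i) u v) ×
    (∀ i j → i ≢ j → Σ (Fin (N H)) λ u → Σ (Fin (N H)) λ v →
       β u ≡ just i × β v ≡ just j × E H u v)

χ : (H : Graph) (x₁ x₂ y₁ z₁ y₂ z₂ : Fin (N H)) → Set
χ H x₁ x₂ y₁ z₁ y₂ z₂ =
  E H x₁ y₂ × E H y₁ y₂ × E H z₁ y₂ × E H z₁ z₂ × E H y₂ z₂ × E H z₂ x₂

Modelsφ : Graph → Set
Modelsφ H =
  Σ (Fin (N H)) λ x₁ → Σ (Fin (N H)) λ x₂ → Σ (Fin (N H)) λ y → Σ (Fin (N H)) λ z →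
    E H x₁ y × E H y z × E H z x₂ ×
    (∀ a b → E H x₁ a × E H a b × E H b x₂ →
       Σ (Fin (N H)) λ c → Σ (Fin (N H)) λ d → χ H x₁ x₂ a b c d)

{-# OPTIONS --safe #-}
module Submission where

-- Take x₁ = v₁, x₂ = v₂, y = a₀, z = b₀ (indices from 0, as in Defs). Let v₁ p q v₂ be a path.
-- If p and q lie in the induced copy of Dₙ, then p = aᵢ and q = bⱼ with j = i or j + 1 = i
-- (mod n), and c, d can be taken to be aᵢ₊₁, bᵢ₊₁ resp. aⱼ, bⱼ₋₁. Otherwise p or q lies outside
-- the copy, and the copy together with the path has a K₅ minor; after rotating Dₙ this leaves
-- three situations (p and q outside, p = a₀, or q = b₀), each with explicit branch sets.

open import Defs
open import Data.Nat using (ℕ; zero; suc; _+_; _≤_; z≤n; s≤s)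
import Data.Nat.Properties as ℕ
open import Data.Fin using (Fin; zero; suc; toℕ; fromℕ; inject₁; lower₁; _≟_)
open import Data.Fin.Patterns using (0F; 1F; 2F; 3F; 4F)
open import Data.Fin.Properties
  using (toℕ-injective; toℕ<n; toℕ-fromℕ; toℕ-inject₁; toℕ-inject₁-≢; toℕ-lower₁;
         lower₁-inject₁′; inject₁-lower₁; any?)
open import Data.Fin.Induction using (<-weakInduction)
open import Data.Maybe using (Maybe; just; nothing)
open import Data.Maybe.Properties using (just-injective)
open import Data.Product using (Σ; ∃; ∄; _×_; _,_; proj₁; proj₂)
import Data.Product as Product
open import Data.Sum using (_⊎_; inj₁; inj₂; [_,_]; swap)
open import Data.Empty using (⊥-elim)
open import Function using (_∘_)
open import Function.Definitions using (Injective)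
open import Relation.Nullary using (¬_; Dec; yes; no; contradiction)
open import Relation.Nullary.Decidable using (map′; _⊎-dec_)
open import Relation.Unary using (Decidable)
open import Relation.Binary.Construct.Closure.ReflexiveTransitive
  using (Star; ε; _◅_; _◅◅_; reverse)
open import Relation.Binary.PropositionalEquality
  using (_≡_; _≢_; refl; sym; trans; cong; subst)

CyclicSucc : (n : ℕ) → Fin n → Fin n → Set
CyclicSucc n i j = suc (toℕ i) ≡ toℕ j ⊎ (suc (toℕ i) ≡ n × toℕ j ≡ 0)

CyclicSucc-functional : ∀ {n} {i j k : Fin n} →
                        CyclicSucc n i j → CyclicSucc n i k → j ≡ k
CyclicSucc-functional (inj₁ i→j) (inj₁ i→k) = toℕ-injective (trans (sym i→j) i→k)
CyclicSucc-functional {j = j} (inj₁ i→j) (inj₂ (i+1≡n , _)) =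
  contradiction (trans (sym i→j) i+1≡n) (ℕ.<⇒≢ (toℕ<n j))
CyclicSucc-functional {k = k} (inj₂ (i+1≡n , _)) (inj₁ i→k) =
  contradiction (trans (sym i→k) i+1≡n) (ℕ.<⇒≢ (toℕ<n k))
CyclicSucc-functional (inj₂ (_ , j≡0)) (inj₂ (_ , k≡0)) = toℕ-injective (trans j≡0 (sym k≡0))

next : ∀ {n} → Fin (suc n) → Fin (suc n)
next {n} i with n ℕ.≟ toℕ i
... | yes _    = zero
... | no n≢i  = suc (lower₁ i n≢i)

prev : ∀ {n} → Fin (suc n) → Fin (suc n)
prev {n} zero = fromℕ n
prev (suc i)  = inject₁ i

next-succ : ∀ {n} (i : Fin (suc n)) → CyclicSucc (suc n) i (next i)
next-succ {n} i with n ℕ.≟ toℕ i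
... | yes n≡i = inj₂ (cong suc (sym n≡i) , refl)
... | no n≢i  = inj₁ (cong suc (sym (toℕ-lower₁ i n≢i)))

prev-succ : ∀ {n} (j : Fin (suc n)) → CyclicSucc (suc n) (prev j) j
prev-succ {n} zero = inj₂ (cong suc (toℕ-fromℕ n) , refl)
prev-succ (suc i)  = inj₁ (cong suc (toℕ-inject₁ i))

prev-next : ∀ {n} (i : Fin (suc n)) → prev (next i) ≡ i
prev-next {n} i with n ℕ.≟ toℕ i
... | yes n≡i = toℕ-injective (trans (toℕ-fromℕ n) n≡i)
... | no n≢i  = inject₁-lower₁ i n≢i

next-inject₁ : ∀ {n} (i : Fin n) → next (inject₁ i) ≡ suc i
next-inject₁ {n} i with n ℕ.≟ toℕ (inject₁ i)
... | yes n≡i = contradiction n≡i (toℕ-inject₁-≢ i)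
... | no n≢i  = cong suc (lower₁-inject₁′ i n≢i)

next-preserves-succ : ∀ {n} {i j : Fin (suc n)} →
                      CyclicSucc (suc n) i j → CyclicSucc (suc n) (next i) (next j)
next-preserves-succ {i = i} i→j =
  subst (λ k → CyclicSucc _ (next i) (next k))
        (CyclicSucc-functional (next-succ i) i→j)
        (next-succ (next i))

DE-sym : ∀ {n u v} → DE n u v → DE n v u
DE-sym = swap

aa-edge : ∀ {n} {i j : Fin n} → CyclicSucc n i j → DE n (a i) (a j)
aa-edge (inj₁ i→j)           = inj₁ (e-aa _ _ i→j)
aa-edge (inj₂ (i+1≡n , j≡0)) = inj₂ (w-aa _ _ j≡0 i+1≡n)

bb-edge : ∀ {n} {i j : Fin n} → CyclicSucc n i j → DE n (b i) (b j)
bb-edge (inj₁ i→j)           = inj₁ (e-bb _ _ i→j)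
bb-edge (inj₂ (i+1≡n , j≡0)) = inj₂ (w-bb _ _ j≡0 i+1≡n)

ab-edge : ∀ {n} {i j : Fin n} → CyclicSucc n i j → DE n (a j) (b i)
ab-edge (inj₁ i→j)           = inj₁ (e-a'b _ _ i→j)
ab-edge (inj₂ (i+1≡n , j≡0)) = inj₁ (w-ab _ _ j≡0 i+1≡n)

ab-edge-inv : ∀ {n} {i j : Fin n} → DE n (a i) (b j) → i ≡ j ⊎ CyclicSucc n j i
ab-edge-inv (inj₁ (e-ab _))             = inj₁ refl
ab-edge-inv (inj₁ (e-a'b _ _ j→i))      = inj₂ (inj₁ j→i)
ab-edge-inv (inj₁ (w-ab _ _ i≡0 j+1≡n)) = inj₂ (inj₂ (j+1≡n , i≡0))
ab-edge-inv (inj₂ ())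

v₁-neighbour : ∀ {n w} → DE n v₁ w → ∃ λ i → a i ≡ w
v₁-neighbour (inj₁ (e-v₁a i)) = i , refl
v₁-neighbour (inj₂ ())

v₂-neighbour : ∀ {n w} → DE n w v₂ → ∃ λ j → b j ≡ w
v₂-neighbour (inj₁ ())
v₂-neighbour (inj₂ (e-v₂b j)) = j , refl

reindex : ∀ {n} → (Fin n → Fin n) → DV n → DV n
reindex ρ v₁    = v₁
reindex ρ v₂    = v₂
reindex ρ (a i) = a (ρ i)
reindex ρ (b i) = b (ρ i)

module _ {n : ℕ} {ρ : Fin n → Fin n}
         (ρ-succ : ∀ {i j} → CyclicSucc n i j → CyclicSucc n (ρ i) (ρ j)) where

  private
    reindex-DBase : ∀ {u v} → DBase n u v → DE n (reindex ρ u) (reindex ρ v)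
    reindex-DBase (e-v₁a i)            = inj₁ (e-v₁a (ρ i))
    reindex-DBase (e-v₂b i)            = inj₁ (e-v₂b (ρ i))
    reindex-DBase (e-ab i)             = inj₁ (e-ab (ρ i))
    reindex-DBase (e-aa _ _ i→j)       = aa-edge (ρ-succ (inj₁ i→j))
    reindex-DBase (e-bb _ _ i→j)       = bb-edge (ρ-succ (inj₁ i→j))
    reindex-DBase (e-a'b _ _ i→j)      = ab-edge (ρ-succ (inj₁ i→j))
    reindex-DBase (w-aa _ _ i≡0 j+1≡n) = DE-sym (aa-edge (ρ-succ (inj₂ (j+1≡n , i≡0))))
    reindex-DBase (w-bb _ _ i≡0 j+1≡n) = DE-sym (bb-edge (ρ-succ (inj₂ (j+1≡n , i≡0))))
    reindex-DBase (w-ab _ _ i≡0 j+1≡n) = ab-edge (ρ-succ (inj₂ (j+1≡n , i≡0)))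

  reindex-DE : ∀ {u v} → DE n u v → DE n (reindex ρ u) (reindex ρ v)
  reindex-DE (inj₁ uv) = reindex-DBase uv
  reindex-DE (inj₂ vu) = DE-sym (reindex-DBase vu)

reindex-injective : ∀ {n} {ρ σ : Fin n → Fin n} →
                    (∀ i → σ (ρ i) ≡ i) → Injective _≡_ _≡_ (reindex ρ)
reindex-injective {ρ = ρ} {σ} σρ {u} {w} ρu≡ρw =
  trans (sym (retract u)) (trans (cong (reindex σ) ρu≡ρw) (retract w))
  where
  retract : ∀ w → reindex σ (reindex ρ w) ≡ w
  retract v₁    = refl
  retract v₂    = refl
  retract (a i) = cong a (σρ i)
  retract (b i) = cong b (σρ i)

record Rotation (n : ℕ) (i : Fin (suc n)) : Set where
  field
    ρ ρ⁻¹  : Fin (suc n) → Fin (suc n)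
    ρ-succ : ∀ {j k} → CyclicSucc (suc n) j k → CyclicSucc (suc n) (ρ j) (ρ k)
    ρ⁻¹-ρ  : ∀ j → ρ⁻¹ (ρ j) ≡ j
    ρ-zero : ρ zero ≡ i

rotation : ∀ {n} (i : Fin (suc n)) → Rotation n i
rotation {n} = <-weakInduction (Rotation n) identity then-next
  where
  identity : Rotation n zero
  identity = record
    { ρ = λ j → j ; ρ⁻¹ = λ j → j ; ρ-succ = λ j→k → j→k ; ρ⁻¹-ρ = λ _ → refl ; ρ-zero = refl }

  then-next : ∀ i → Rotation n (inject₁ i) → Rotation n (suc i)
  then-next i r = record
    { ρ      = next ∘ ρ
    ; ρ⁻¹    = ρ⁻¹ ∘ prev
    ; ρ-succ = λ j→k → next-preserves-succ (ρ-succ j→k)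
    ; ρ⁻¹-ρ  = λ j → trans (cong ρ⁻¹ (prev-next (ρ j))) (ρ⁻¹-ρ j)
    ; ρ-zero = trans (cong next ρ-zero) (next-inject₁ i)
    }
    where open Rotation r

record SubgraphD (n : ℕ) (H : Graph) : Set where
  field
    vertex           : DV n → Fin (N H)
    vertex-injective : Injective _≡_ _≡_ vertex
    edge             : ∀ {u v} → DE n u v → E H (vertex u) (vertex v)

Outside : ∀ {n H} → SubgraphD n H → Fin (N H) → Set
Outside S u = ∄ λ w → SubgraphD.vertex S w ≡ u

module _ {n : ℕ} {H : Graph} (S : SubgraphD (suc n) H) (i : Fin (suc n)) where
  open SubgraphD S
  open Rotation (rotation i)

  rotate : SubgraphD (suc n) H
  rotate = record
    { vertex           = vertex ∘ reindex ρ
    ; vertex-injective = reindex-injective {σ = ρ⁻¹} ρ⁻¹-ρ ∘ vertex-injective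
    ; edge             = edge ∘ reindex-DE ρ-succ
    }

  rotate-a₀ : SubgraphD.vertex rotate (a zero) ≡ vertex (a i)
  rotate-a₀ = cong (vertex ∘ a) ρ-zero

  rotate-b₀ : SubgraphD.vertex rotate (b zero) ≡ vertex (b i)
  rotate-b₀ = cong (vertex ∘ b) ρ-zero

  rotate-outside : ∀ {u} → Outside S u → Outside rotate u
  rotate-outside u∉ (w , w↦u) = u∉ (reindex ρ w , w↦u)

Searchable : Set → Set₁
Searchable A = ∀ {P : A → Set} → Decidable P → Dec (∃ P)

⊎-searchable : ∀ {A B} → Searchable A → Searchable B → Searchable (A ⊎ B)
⊎-searchable search-A search-B {P} P? =
  map′ merge split (search-A (P? ∘ inj₁) ⊎-dec search-B (P? ∘ inj₂))
  where
  merge : ∃ (P ∘ inj₁) ⊎ ∃ (P ∘ inj₂) → ∃ P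
  merge (inj₁ (x , p)) = inj₁ x , p
  merge (inj₂ (y , p)) = inj₂ y , p

  split : ∃ P → ∃ (P ∘ inj₁) ⊎ ∃ (P ∘ inj₂)
  split (inj₁ x , p) = inj₁ (x , p)
  split (inj₂ y , p) = inj₂ (y , p)

DV-searchable : ∀ {n} → Searchable (DV n)
DV-searchable {P = P} P? =
  map′ merge split (P? v₁ ⊎-dec P? v₂ ⊎-dec any? (P? ∘ a) ⊎-dec any? (P? ∘ b))
  where
  merge : P v₁ ⊎ P v₂ ⊎ ∃ (P ∘ a) ⊎ ∃ (P ∘ b) → ∃ P
  merge (inj₁ p)                     = v₁ , p
  merge (inj₂ (inj₁ p))              = v₂ , p
  merge (inj₂ (inj₂ (inj₁ (i , p)))) = a i , p
  merge (inj₂ (inj₂ (inj₂ (i , p)))) = b i , p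

  split : ∃ P → P v₁ ⊎ P v₂ ⊎ ∃ (P ∘ a) ⊎ ∃ (P ∘ b)
  split (v₁ , p)  = inj₁ p
  split (v₂ , p)  = inj₂ (inj₁ p)
  split (a i , p) = inj₂ (inj₂ (inj₁ (i , p)))
  split (b i , p) = inj₂ (inj₂ (inj₂ (i , p)))

[,]-injective : ∀ {A B C : Set} {f : A → C} {g : B → C} →
                Injective _≡_ _≡_ f → Injective _≡_ _≡_ g → (∀ x y → f x ≢ g y) →
                Injective _≡_ _≡_ [ f , g ]
[,]-injective f-inj g-inj disjoint {inj₁ x} {inj₁ y} fx≡fy = cong inj₁ (f-inj fx≡fy)
[,]-injective f-inj g-inj disjoint {inj₁ x} {inj₂ y} fx≡gy = contradiction fx≡gy (disjoint x y)
[,]-injective f-inj g-inj disjoint {inj₂ x} {inj₁ y} gx≡fy = contradiction (sym gx≡fy) (disjoint y x)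
[,]-injective f-inj g-inj disjoint {inj₂ x} {inj₂ y} gx≡gy = cong inj₂ (g-inj gx≡gy)

SameBranch : {X : Set} → (X → X → Set) → (X → Fin 5) → X → X → Set
SameBranch R branch x y = R x y × branch x ≡ branch y

record K5Model (X : Set) (R : X → X → Set) : Set where
  field
    branch        : X → Fin 5
    centre        : Fin 5 → X
    branch-centre : ∀ i → branch (centre i) ≡ i
    connected     : ∀ x → Star (SameBranch R branch) x (centre (branch x))
    joined        : ∀ i j → i ≢ j →
                    Σ X λ x → Σ X λ y → branch x ≡ i × branch y ≡ j × R x y

module _ {A : Fin 5 → Fin 5 → Set} (A-sym : ∀ {i j} → A i j → A j i)
         (a01 : A 0F 1F) (a02 : A 0F 2F) (a03 : A 0F 3F) (a04 : A 0F 4F)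
         (a12 : A 1F 2F) (a13 : A 1F 3F) (a14 : A 1F 4F)
         (a23 : A 2F 3F) (a24 : A 2F 4F) (a34 : A 3F 4F) where

  all-distinct-pairs : ∀ i j → i ≢ j → A i j
  all-distinct-pairs 0F 1F _ = a01
  all-distinct-pairs 0F 2F _ = a02
  all-distinct-pairs 0F 3F _ = a03
  all-distinct-pairs 0F 4F _ = a04
  all-distinct-pairs 1F 2F _ = a12
  all-distinct-pairs 1F 3F _ = a13
  all-distinct-pairs 1F 4F _ = a14
  all-distinct-pairs 2F 3F _ = a23
  all-distinct-pairs 2F 4F _ = a24
  all-distinct-pairs 3F 4F _ = a34
  all-distinct-pairs 1F 0F _ = A-sym a01
  all-distinct-pairs 2F 0F _ = A-sym a02
  all-distinct-pairs 3F 0F _ = A-sym a03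
  all-distinct-pairs 4F 0F _ = A-sym a04
  all-distinct-pairs 2F 1F _ = A-sym a12
  all-distinct-pairs 3F 1F _ = A-sym a13
  all-distinct-pairs 4F 1F _ = A-sym a14
  all-distinct-pairs 3F 2F _ = A-sym a23
  all-distinct-pairs 4F 2F _ = A-sym a24
  all-distinct-pairs 4F 3F _ = A-sym a34
  all-distinct-pairs 0F 0F i≢i = contradiction refl i≢i
  all-distinct-pairs 1F 1F i≢i = contradiction refl i≢i
  all-distinct-pairs 2F 2F i≢i = contradiction refl i≢i
  all-distinct-pairs 3F 3F i≢i = contradiction refl i≢i
  all-distinct-pairs 4F 4F i≢i = contradiction refl i≢i

module _ {H : Graph} {X : Set} {h : X → Fin (N H)}
         (h-injective : Injective _≡_ _≡_ h) (search : Searchable X) where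

  K5Model⇒HasK5Minor : K5Model X (λ x y → E H (h x) (h y)) → HasK5Minor H
  K5Model⇒HasK5Minor M = β , nonempty , walk , adjacent
    where
    open K5Model M

    Link : X → X → Set
    Link = SameBranch (λ x y → E H (h x) (h y)) branch

    preimage : ∀ u → Dec (∃ λ x → h x ≡ u)
    preimage u = search (λ x → h x ≟ u)

    branchOf : ∀ {u} → Dec (∃ λ x → h x ≡ u) → Maybe (Fin 5)
    branchOf (yes (x , _)) = just (branch x)
    branchOf (no _)        = nothing

    β : Fin (N H) → Maybe (Fin 5)
    β u = branchOf (preimage u)

    β-image : ∀ {x i} → branch x ≡ i → β (h x) ≡ just i
    β-image {x} refl = go (preimage (h x))
      where
      go : (d : Dec (∃ λ y → h y ≡ h x)) → branchOf d ≡ just (branch x)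
      go (yes (y , hy≡hx)) = cong (just ∘ branch) (h-injective hy≡hx)
      go (no ∄x)           = contradiction (x , refl) ∄x

    β-preimage : ∀ {u i} (d : Dec (∃ λ x → h x ≡ u)) → branchOf d ≡ just i →
                 ∃ λ x → h x ≡ u × branch x ≡ i
    β-preimage (yes (x , hx≡u)) βu≡i = x , hx≡u , just-injective βu≡i
    β-preimage (no _) ()

    walk-in-H : ∀ {x y i} → branch x ≡ i → Star Link x y →
                WalkIn H (λ w → β w ≡ just i) (h x) (h y)
    walk-in-H x∈i ε                   = here (β-image x∈i)
    walk-in-H x∈i ((xy , same) ◅ y⇝z) =
      step (β-image x∈i) xy (walk-in-H (trans (sym same) x∈i) y⇝z)

    within-branch : ∀ {x y} → branch x ≡ branch y → Star Link x y
    within-branch {x} {y} same =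
      connected x ◅◅ subst (λ c → Star Link (centre c) y) (sym same)
                           (reverse (λ (xy , x~y) → E-sym H xy , sym x~y) (connected y))

    nonempty : ∀ i → ∃ λ u → β u ≡ just i
    nonempty i = h (centre i) , β-image (branch-centre i)

    walk : ∀ i u v → β u ≡ just i → β v ≡ just i → WalkIn H (λ w → β w ≡ just i) u v
    walk i u v βu≡i βv≡i with β-preimage (preimage u) βu≡i | β-preimage (preimage v) βv≡i
    ... | x , refl , x∈i | y , refl , y∈i = walk-in-H x∈i (within-branch (trans x∈i (sym y∈i)))

    adjacent : ∀ i j → i ≢ j → ∃ λ u → ∃ λ v → β u ≡ just i × β v ≡ just j × E H u v
    adjacent i j i≢j with joined i j i≢j
    ... | x , y , x∈i , y∈j , xy = h x , h y , β-image x∈i , β-image y∈j , xy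

module BranchSets {H : Graph} {m k : ℕ} (S : SubgraphD (3 + m) H)
                  (extra : Fin k → Fin (N H)) (extra-branch : Fin k → Fin 5)
                  (a₀-branch b₀-branch : Fin 5) (centre₂ : DV (3 + m) ⊎ Fin k) where
  open SubgraphD S

  X : Set
  X = DV (3 + m) ⊎ Fin k

  h : X → Fin (N H)
  h = [ vertex , extra ]

  Adj : X → X → Set
  Adj x y = E H (h x) (h y)

  branch : X → Fin 5
  branch (inj₁ v₁)                 = 0F
  branch (inj₁ v₂)                 = 1F
  branch (inj₁ (a zero))           = a₀-branch
  branch (inj₁ (b zero))           = b₀-branch
  branch (inj₁ (a (suc zero)))     = 3F
  branch (inj₁ (b (suc zero)))     = 3F
  branch (inj₁ (a (suc (suc _))))  = 4F
  branch (inj₁ (b (suc (suc _))))  = 4F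
  branch (inj₂ t)                  = extra-branch t

  centre : Fin 5 → X
  centre 0F = inj₁ v₁
  centre 1F = inj₁ v₂
  centre 2F = centre₂
  centre 3F = inj₁ (a 1F)
  centre 4F = inj₁ (a 2F)

  Walk : X → X → Set
  Walk = Star (SameBranch Adj branch)

  Join : Fin 5 → Fin 5 → Set
  Join i j = Σ X λ x → Σ X λ y → branch x ≡ i × branch y ≡ j × Adj x y

  Join-sym : ∀ {i j} → Join i j → Join j i
  Join-sym (x , y , x∈i , y∈j , xy) = y , x , y∈j , x∈i , E-sym H xy

  D-join : ∀ {u v} → DE (3 + m) u v → Join (branch (inj₁ u)) (branch (inj₁ v))
  D-join uv = inj₁ _ , inj₁ _ , refl , refl , edge uv

  D-step : ∀ {u v w} → DE (3 + m) u v → branch (inj₁ u) ≡ branch (inj₁ v) →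
           Walk (inj₁ v) w → Walk (inj₁ u) w
  D-step uv same v⇝w = (edge uv , same) ◅ v⇝w

  a-wrap : DE (3 + m) (a 0F) (a (prev 0F))
  a-wrap = DE-sym (aa-edge (prev-succ 0F))

  b-wrap : DE (3 + m) (b 0F) (b (prev 0F))
  b-wrap = DE-sym (bb-edge (prev-succ 0F))

  a-descent : ∀ i → Walk (inj₁ (a (suc (suc i)))) (inj₁ (a 2F))
  a-descent = <-weakInduction (λ i → Walk (inj₁ (a (suc (suc i)))) (inj₁ (a 2F))) ε
    (λ i → D-step (inj₂ (e-aa _ _ (cong (3 +_) (toℕ-inject₁ i)))) refl)

  tail-connected : ∀ i → Walk (inj₁ (a (suc i))) (centre (branch (inj₁ (a (suc i))))) ×
                         Walk (inj₁ (b (suc i))) (centre (branch (inj₁ (b (suc i)))))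
  tail-connected 0F      = ε , D-step (DE-sym (inj₁ (e-ab 1F))) refl ε
  tail-connected (suc i) = a-descent i , D-step (DE-sym (inj₁ (e-ab _))) refl (a-descent i)

  K5-minor : Injective _≡_ _≡_ extra → (∀ t → Outside S (extra t)) →
             branch centre₂ ≡ 2F →
             Walk (inj₁ (a 0F)) (centre a₀-branch) →
             Walk (inj₁ (b 0F)) (centre b₀-branch) →
             (∀ t → Walk (inj₂ t) (centre (extra-branch t))) →
             Join 0F 1F → Join 0F 2F → Join 1F 2F → Join 2F 3F → Join 2F 4F →
             HasK5Minor H
  K5-minor extra-injective extra-outside centre₂∈2 a₀-walk b₀-walk extra-walk
           j01 j02 j12 j23 j24 =
    K5Model⇒HasK5Minor h-injective (⊎-searchable DV-searchable any?) (record
      { branch        = branch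
      ; centre        = centre
      ; branch-centre = λ { 0F → refl ; 1F → refl ; 2F → centre₂∈2 ; 3F → refl ; 4F → refl }
      ; connected     = connected
      ; joined        = all-distinct-pairs Join-sym j01 j02
                          (D-join (inj₁ (e-v₁a 1F))) (D-join (inj₁ (e-v₁a 2F))) j12
                          (D-join (inj₁ (e-v₂b 1F))) (D-join (inj₁ (e-v₂b 2F))) j23 j24
                          (D-join (inj₁ (e-aa 1F 2F refl)))
      })
    where
    h-injective : Injective _≡_ _≡_ h
    h-injective = [,]-injective vertex-injective extra-injective
                    (λ w t w↦t → extra-outside t (w , w↦t))

    connected : ∀ x → Walk x (centre (branch x))
    connected (inj₁ v₁)          = ε
    connected (inj₁ v₂)          = ε
    connected (inj₁ (a zero))    = a₀-walk
    connected (inj₁ (b zero))    = b₀-walk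
    connected (inj₁ (a (suc i))) = proj₁ (tail-connected i)
    connected (inj₁ (b (suc i))) = proj₂ (tail-connected i)
    connected (inj₂ t)           = extra-walk t

module _ {H : Graph} {m : ℕ} (S : SubgraphD (3 + m) H) where
  open SubgraphD S

  -- branch sets {v₁, p}, {v₂, q}, {a₀, b₀}, {a₁, b₁}, {aᵢ, bᵢ | i ≥ 2}
  outerPath⇒K5Minor : ∀ {p q} → E H (vertex v₁) p → E H p q → E H q (vertex v₂) →
                      Outside S p → Outside S q → HasK5Minor H
  outerPath⇒K5Minor {p} {q} v₁p pq qv₂ p∉ q∉ =
    K5-minor extra-injective (λ { 0F → p∉ ; 1F → q∉ }) refl
      ε
      (D-step (DE-sym (inj₁ (e-ab 0F))) refl ε)
      (λ { 0F → (E-sym H v₁p , refl) ◅ ε ; 1F → (qv₂ , refl) ◅ ε })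
      (inj₂ 0F , inj₂ 1F , refl , refl , pq)
      (D-join (inj₁ (e-v₁a 0F)))
      (D-join (inj₁ (e-v₂b 0F)))
      (D-join (inj₁ (e-aa 0F 1F refl)))
      (D-join a-wrap)
    where
    extra : Fin 2 → Fin (N H)
    extra 0F = p
    extra 1F = q

    extra-injective : Injective _≡_ _≡_ extra
    extra-injective {0F} {0F} _    = refl
    extra-injective {0F} {1F} refl = contradiction pq (E-irr H)
    extra-injective {1F} {0F} refl = contradiction pq (E-irr H)
    extra-injective {1F} {1F} _    = refl

    extra-branch : Fin 2 → Fin 5
    extra-branch 0F = 0F
    extra-branch 1F = 1F

    open BranchSets S extra extra-branch 2F 2F (inj₁ (a 0F))

  -- branch sets {v₁, a₀}, {v₂, q}, {b₀}, {a₁, b₁}, {aᵢ, bᵢ | i ≥ 2}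
  a₀Path⇒K5Minor : ∀ {q} → E H (vertex (a 0F)) q → E H q (vertex v₂) →
                   Outside S q → HasK5Minor H
  a₀Path⇒K5Minor {q} a₀q qv₂ q∉ =
    K5-minor (λ { {0F} {0F} _ → refl }) (λ { 0F → q∉ }) refl
      (D-step (DE-sym (inj₁ (e-v₁a 0F))) refl ε)
      ε
      (λ { 0F → (qv₂ , refl) ◅ ε })
      (inj₁ (a 0F) , inj₂ 0F , refl , refl , a₀q)
      (D-join (inj₁ (e-ab 0F)))
      (D-join (inj₁ (e-v₂b 0F)))
      (D-join (inj₁ (e-bb 0F 1F refl)))
      (D-join b-wrap)
    where open BranchSets {k = 1} S (λ _ → q) (λ _ → 1F) 0F 2F (inj₁ (b 0F))

  -- branch sets {v₁, p}, {v₂, b₀}, {a₀}, {a₁, b₁}, {aᵢ, bᵢ | i ≥ 2}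
  b₀Path⇒K5Minor : ∀ {p} → E H (vertex v₁) p → E H p (vertex (b 0F)) →
                   Outside S p → HasK5Minor H
  b₀Path⇒K5Minor {p} v₁p pb₀ p∉ =
    K5-minor (λ { {0F} {0F} _ → refl }) (λ { 0F → p∉ }) refl
      ε
      (D-step (DE-sym (inj₁ (e-v₂b 0F))) refl ε)
      (λ { 0F → (E-sym H v₁p , refl) ◅ ε })
      (inj₂ 0F , inj₁ (b 0F) , refl , refl , pb₀)
      (D-join (inj₁ (e-v₁a 0F)))
      (D-join (DE-sym (inj₁ (e-ab 0F))))
      (D-join (inj₁ (e-aa 0F 1F refl)))
      (D-join a-wrap)
    where open BranchSets {k = 1} S (λ _ → p) (λ _ → 0F) 2F 1F (inj₁ (a 0F))

module _ {H : Graph} {m : ℕ} (S : SubgraphD (3 + m) H) where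
  open SubgraphD S

  aPath⇒K5Minor : ∀ i {q} → E H (vertex (a i)) q → E H q (vertex v₂) →
                  Outside S q → HasK5Minor H
  aPath⇒K5Minor i {q} aᵢq qv₂ q∉ =
    a₀Path⇒K5Minor (rotate S i) (subst (λ x → E H x q) (sym (rotate-a₀ S i)) aᵢq) qv₂
                   (rotate-outside S i q∉)

  bPath⇒K5Minor : ∀ j {p} → E H (vertex v₁) p → E H p (vertex (b j)) →
                  Outside S p → HasK5Minor H
  bPath⇒K5Minor j {p} v₁p pbⱼ p∉ =
    b₀Path⇒K5Minor (rotate S j) v₁p (subst (E H p) (sym (rotate-b₀ S j)) pbⱼ)
                   (rotate-outside S j p∉)

module _ {n : ℕ} {H : Graph} (S : SubgraphD (suc n) H) where
  open SubgraphD S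

  χ-from-ab-edge : ∀ {i j} → DE (suc n) (a i) (b j) →
                   Σ (Fin (N H)) λ c → Σ (Fin (N H)) λ d →
                     χ H (vertex v₁) (vertex v₂) (vertex (a i)) (vertex (b j)) c d
  χ-from-ab-edge {i} {j} aᵢbⱼ with ab-edge-inv aᵢbⱼ
  ... | inj₁ refl =
    let i→i⁺ = next-succ i in
    vertex (a (next i)) , vertex (b (next i)) ,
    edge (inj₁ (e-v₁a _)) , edge (aa-edge i→i⁺) , edge (DE-sym (ab-edge i→i⁺)) ,
    edge (bb-edge i→i⁺) , edge (inj₁ (e-ab _)) , edge (inj₂ (e-v₂b _))
  ... | inj₂ j→i =
    let j⁻→j = prev-succ j in
    vertex (a j) , vertex (b (prev j)) ,
    edge (inj₁ (e-v₁a _)) , edge (DE-sym (aa-edge j→i)) , edge (DE-sym (inj₁ (e-ab _))) ,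
    edge (DE-sym (bb-edge j⁻→j)) , edge (ab-edge j⁻→j) , edge (inj₂ (e-v₂b _))

module _ {H : Graph} {m : ℕ} (S : SubgraphD (3 + m) H)
         (reflects : ∀ {u v} → E H (SubgraphD.vertex S u) (SubgraphD.vertex S v) → DE (3 + m) u v)
         where
  open SubgraphD S

  image? : ∀ u → Dec (∃ λ w → vertex w ≡ u)
  image? u = DV-searchable (λ w → vertex w ≟ u)

  v₁-neighbour-or-outside : ∀ {p} → E H (vertex v₁) p → (∃ λ i → vertex (a i) ≡ p) ⊎ Outside S p
  v₁-neighbour-or-outside {p} v₁p with image? p
  ... | yes (w , refl) = inj₁ (Product.map₂ (cong vertex) (v₁-neighbour (reflects v₁p)))
  ... | no p∉          = inj₂ p∉

  v₂-neighbour-or-outside : ∀ {q} → E H q (vertex v₂) → (∃ λ j → vertex (b j) ≡ q) ⊎ Outside S q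
  v₂-neighbour-or-outside {q} qv₂ with image? q
  ... | yes (w , refl) = inj₁ (Product.map₂ (cong vertex) (v₂-neighbour (reflects qv₂)))
  ... | no q∉          = inj₂ q∉

  path-closes : ¬ HasK5Minor H → ∀ {p q} → E H (vertex v₁) p → E H p q → E H q (vertex v₂) →
                Σ (Fin (N H)) λ c → Σ (Fin (N H)) λ d → χ H (vertex v₁) (vertex v₂) p q c d
  path-closes noK5 v₁p pq qv₂ with v₁-neighbour-or-outside v₁p | v₂-neighbour-or-outside qv₂
  ... | inj₁ (i , refl) | inj₁ (j , refl) = χ-from-ab-edge S (reflects pq)
  ... | inj₁ (i , refl) | inj₂ q∉         = ⊥-elim (noK5 (aPath⇒K5Minor S i pq qv₂ q∉))
  ... | inj₂ p∉         | inj₁ (j , refl) = ⊥-elim (noK5 (bPath⇒K5Minor S j v₁p pq p∉))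
  ... | inj₂ p∉         | inj₂ q∉         = ⊥-elim (noK5 (outerPath⇒K5Minor S v₁p pq qv₂ p∉ q∉))

lemma5p7 : (H : Graph) → ¬ HasK5Minor H →
    (n : ℕ) → 3 ≤ n → InducedD n H → Modelsφ H
lemma5p7 H noK5 (suc (suc (suc m))) (s≤s (s≤s (s≤s z≤n))) (f , f-injective , f-adjacency) =
  f v₁ , f v₂ , f (a 0F) , f (b 0F) ,
  edge (inj₁ (e-v₁a 0F)) , edge (inj₁ (e-ab 0F)) , edge (inj₂ (e-v₂b 0F)) ,
  λ p q (v₁p , pq , qv₂) → path-closes S reflects noK5 v₁p pq qv₂
  where
  S : SubgraphD (3 + m) H
  S = record
    { vertex           = f
    ; vertex-injective = λ {u} {v} → f-injective u v
    ; edge             = λ {u} {v} → proj₁ (f-adjacency u v)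
    }
  open SubgraphD S using (edge)

  reflects : ∀ {u v} → E H (f u) (f v) → DE (3 + m) u v
  reflects {u} {v} = proj₂ (f-adjacency u v)
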